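{- Let $d_1,\dots,d_k\in\{1,\dots,5\}$, let $Z^{(1,0)}$ and $Z^{(0,1)}$ be the boundary points of the cylinder set $C(d_1,\dots,d_k)$, and let $Z$ be a rational point in the interior of $C(d_1,\dots,d_k)$. Then \[ \max\{\mathrm{Ht}(Z^{(1,0)}),\mathrm{Ht}(Z^{(0,1)})\}\le\mathrm{Ht}(Z). \]
   Context: Let $\mathcal{X}=\{(x,y)\in\mathbb{R}^2: x^2+xy+y^2=1,\ x,y\ge0\}$ and $\mathcal{Z}=\mathcal{X}\cap\mathbb{Q}^2$; for $Z=(a/c,b/c)\in\mathcal{Z}$ with $a,b,c$ coprime nonnegative integers and $c>0$, $\mathrm{Ht}(Z)=c$. A vector $(v_1,v_2,v_3)$ with $v_3\ne0$ represents $(v_1/v_3,v_2/v_3)$; positive means $v_3>0$. Let $M_1=\begin{pmatrix}-3&1&4\\-4&-1&4\\-6&0&7\end{pmatrix}$, $M_2=\begin{pmatrix}4&1&4\\3&-1&4\\6&0&7\end{pmatrix}$, $M_3=\begin{pmatrix}4&3&4\\3&4&4\\6&6&7\end{pmatrix}$, $M_4=\begin{pmatrix}-1&3&4\\1&4&4\\0&6&7\end{pmatrix}$, $M_5=\begin{pmatrix}-1&-4&4\\1&-3&4\\0&-6&7\end{pmatrix}$. The cylinder set $C(d_1,\dots,d_k)$ is the set of points represented by $M_{d_1}\cdots M_{d_k}\mathbf{v}$ with $\mathbf{v}$ a positive vector representing a point of $\mathcal{X}$; it is a closed subarc of $\mathcal{X}$ whose two boundary points $Z^{(1,0)}$ and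 $Z^{(0,1)}$ are represented by $M_{d_1}\cdots M_{d_k}(1,0,1)^T$ and $M_{d_1}\cdots M_{d_k}(0,1,1)^T$. Its interior consists of its points other than these two. -}

module Defs where

open import Data.Nat as ℕ using (ℕ; suc)
open import Data.Nat.GCD using (gcd)
open import Data.Integer as ℤ using (ℤ; +_; -[1+_]; 0ℤ; 1ℤ)
open import Data.Rational as ℚ using (ℚ)
open import Data.Product using (_×_; _,_; ∃; ∃-syntax)
open import Relation.Binary.PropositionalEquality using (_≡_; _≢_)

V3 : Set
V3 = ℤ × ℤ × ℤ

Mat : Set
Mat = V3 × V3 × V3

dot : V3 → V3 → ℤ
dot (a , b , c) (x , y , z) = a ℤ.* x ℤ.+ b ℤ.* y ℤ.+ c ℤ.* z

_·_ : Mat → V3 → V3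
(r₁ , r₂ , r₃) · v = dot r₁ v , dot r₂ v , dot r₃ v

n : ℕ → ℤ
n k = + k

m : ℕ → ℤ
m 0 = 0ℤ
m (suc k) = -[1+ k ]

-- The matrices M₁ … M₅ of the paper (M d for d ∈ {1,…,5}; other indices
-- are never used, since the theorem assumes 1 ≤ dᵢ ≤ 5).
M : ℕ → Mat
M 1 = (m 3 , n 1 , n 4) , (m 4 , m 1 , n 4) , (m 6 , n 0 , n 7)
M 2 = (n 4 , n 1 , n 4) , (n 3 , m 1 , n 4) , (n 6 , n 0 , n 7)
M 3 = (n 4 , n 3 , n 4) , (n 3 , n 4 , n 4) , (n 6 , n 6 , n 7)
M 4 = (m 1 , n 3 , n 4) , (n 1 , n 4 , n 4) , (n 0 , n 6 , n 7)
M 5 = (m 1 , m 4 , n 4) , (n 1 , m 3 , n 4) , (n 0 , m 6 , n 7)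
M _ = (0ℤ , 0ℤ , 0ℤ) , (0ℤ , 0ℤ , 0ℤ) , (0ℤ , 0ℤ , 0ℤ)

open import Data.List using (List; []; _∷_)

applyDigits : List ℕ → V3 → V3
applyDigits []       v = v
applyDigits (d ∷ ds) v = M d · applyDigits ds v

Point : Set
Point = ℚ × ℚ

toℚ : ℤ → ℚ
toℚ z = z ℚ./ 1

-- The vector w = (w₁,w₂,w₃) with w₃ ≠ 0 represents Z = (w₁/w₃ , w₂/w₃).
Represents : V3 → Point → Set
Represents (w₁ , w₂ , w₃) (x , y) =
  (w₃ ≢ 0ℤ) × (x ℚ.* toℚ w₃ ≡ toℚ w₁) × (y ℚ.* toℚ w₃ ≡ toℚ w₂)

-- v is a positive vector representing a point of 𝒳:
-- v₃ > 0, v₁/v₃ ≥ 0, v₂/v₃ ≥ 0, and (v₁/v₃)² + (v₁/v₃)(v₂/v₃) + (v₂/v₃)² = 1.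
PositiveOnX : V3 → Set
PositiveOnX (v₁ , v₂ , v₃) =
  (0ℤ ℤ.< v₃) × (0ℤ ℤ.≤ v₁) × (0ℤ ℤ.≤ v₂) ×
  (v₁ ℤ.* v₁ ℤ.+ v₁ ℤ.* v₂ ℤ.+ v₂ ℤ.* v₂ ≡ v₃ ℤ.* v₃)

InCylinder : List ℕ → Point → Set
InCylinder ds Z = ∃[ v ] (PositiveOnX v × Represents (applyDigits ds v) Z)

HasHt : Point → ℕ → Set
HasHt (x , y) c = ∃[ a ] ∃[ b ] ∃[ k ]
  (c ≡ suc k) × (gcd (gcd a b) c ≡ 1) ×
  (x ≡ (+ a) ℚ./ suc k) × (y ≡ (+ b) ℚ./ suc k)

{-# OPTIONS --safe #-}

-- Each digit matrix satisfies L M_d = T_d L with T_d ≥ 0 (L, T below), so every M_d is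
-- monotone for the preorder w ⊑ w′ :⇔ L w ≤ L w′, and so is the third coordinate, which
-- equals ℓ₁ + ℓ₂ + 3ℓ₃.  Write Z = (a/h, b/h) in lowest terms.  As Z is interior, it is
-- represented by M_{d₁}⋯M_{dₖ} v with v on the cone x² + xy + y² = z² and v₁, v₂ > 0.
-- Pulling (a, b, h) back through the inverse matrices gives an integer vector u proportional
-- to v, hence also on the cone with positive coordinates; integrality then forces ℓ₁ u ≥ 1,
-- ℓ₂ u ≥ 1, ℓ₃ u ≥ 0, i.e. (1,0,1) ⊑ u and (0,1,1) ⊑ u.  So h, the third coordinate of
-- M_{d₁}⋯M_{dₖ} u, is at least the third coordinate of M_{d₁}⋯M_{dₖ} (1,0,1), which is a
-- positive multiple of Ht(Z^{(1,0)}); likewise for Z^{(0,1)}.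

module Submission where

open import Defs
open import Data.Empty using (⊥-elim)
open import Data.Integer as ℤ using (ℤ; +_; +0; +[1+_]; -[1+_]; 0ℤ; 1ℤ; _*_; _+_; -_; +≤+; +<+)
import Data.Integer.Properties as ℤP
open import Data.Integer.Solver using (module +-*-Solver)
open import Data.List using (List; []; _∷_)
open import Data.List.Relation.Unary.All using (All; []; _∷_)
open import Data.Nat as ℕ using (ℕ; suc; s≤s; z≤n; _≤_; _⊔_)
import Data.Nat.Coprimality as Coprime
open import Data.Nat.Divisibility using (_∣_; divides; ∣⇒≤)
open import Data.Nat.GCD using (gcd; gcd-greatest; c*gcd[m,n]≡gcd[cm,cn])
import Data.Nat.Properties as ℕP
open import Data.Product using (_×_; _,_; ∃-syntax; proj₁; proj₂)
open import Data.Rational as ℚ using (ℚ; mkℚ; ↥_; ↧_)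
import Data.Rational.Properties as ℚP
import Data.Rational.Unnormalised.Base as ℚᵘ
import Data.Rational.Unnormalised.Properties as ℚᵘP
open import Function using (_∘_; _$_)
open import Relation.Binary.PropositionalEquality

open +-*-Solver using (solve; _:=_; con; _:+_; _:*_; _:-_)

infix 30 _ᵀ
infix 4 _≤ᵛ_ _⊑_

cong-triple : ∀ {a b c a′ b′ c′ : ℤ} → a ≡ a′ → b ≡ b′ → c ≡ c′ → (a , b , c) ≡ (a′ , b′ , c′)
cong-triple refl refl refl = refl

_⊙_ : ℤ → V3 → V3
k ⊙ (x , y , z) = k * x , k * y , k * z

third : V3 → ℤ
third (_ , _ , z) = z

e₁₀ e₀₁ : V3
e₁₀ = 1ℤ , 0ℤ , 1ℤ
e₀₁ = 0ℤ , 1ℤ , 1ℤ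

_ᵀ : Mat → Mat
((a , b , c) , (d , e , f) , (g , h , i)) ᵀ = (a , d , g) , (b , e , h) , (c , f , i)

_⊗_ : Mat → Mat → Mat
(r₁ , r₂ , r₃) ⊗ B = (B ᵀ) · r₁ , (B ᵀ) · r₂ , (B ᵀ) · r₃

I₃ : Mat
I₃ = (1ℤ , 0ℤ , 0ℤ) , (0ℤ , 1ℤ , 0ℤ) , (0ℤ , 0ℤ , 1ℤ)

dot-· : ∀ r B w → dot r (B · w) ≡ dot ((B ᵀ) · r) w
dot-· (r₁ , r₂ , r₃) ((a , b , c) , (d , e , f) , (g , h , i)) (x , y , z) =
  solve 15 (λ r₁ r₂ r₃ a b c d e f g h i x y z →
      r₁ :* (a :* x :+ b :* y :+ c :* z) :+ r₂ :* (d :* x :+ e :* y :+ f :* z)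
        :+ r₃ :* (g :* x :+ h :* y :+ i :* z)
    := (a :* r₁ :+ d :* r₂ :+ g :* r₃) :* x :+ (b :* r₁ :+ e :* r₂ :+ h :* r₃) :* y
        :+ (c :* r₁ :+ f :* r₂ :+ i :* r₃) :* z)
    refl r₁ r₂ r₃ a b c d e f g h i x y z

·-⊗ : ∀ A B w → A · (B · w) ≡ (A ⊗ B) · w
·-⊗ (r₁ , r₂ , r₃) B w = cong-triple (dot-· r₁ B w) (dot-· r₂ B w) (dot-· r₃ B w)

I₃-· : ∀ w → I₃ · w ≡ w
I₃-· (x , y , z) = cong-triple
  (solve 3 (λ x y z → con 1ℤ :* x :+ con 0ℤ :* y :+ con 0ℤ :* z := x) refl x y z)
  (solve 3 (λ x y z → con 0ℤ :* x :+ con 1ℤ :* y :+ con 0ℤ :* z := y) refl x y z)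
  (solve 3 (λ x y z → con 0ℤ :* x :+ con 0ℤ :* y :+ con 1ℤ :* z := z) refl x y z)

dot-⊙ : ∀ r k w → dot r (k ⊙ w) ≡ k * dot r w
dot-⊙ (a , b , c) k (x , y , z) =
  solve 7 (λ a b c k x y z → a :* (k :* x) :+ b :* (k :* y) :+ c :* (k :* z)
                           := k :* (a :* x :+ b :* y :+ c :* z))
    refl a b c k x y z

·-⊙ : ∀ A k w → A · (k ⊙ w) ≡ k ⊙ (A · w)
·-⊙ (r₁ , r₂ , r₃) k w = cong-triple (dot-⊙ r₁ k w) (dot-⊙ r₂ k w) (dot-⊙ r₃ k w)

_≤ᵛ_ : V3 → V3 → Set
(x , y , z) ≤ᵛ (x′ , y′ , z′) = x ℤ.≤ x′ × y ℤ.≤ y′ × z ℤ.≤ z′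

0ᵛ : V3
0ᵛ = 0ℤ , 0ℤ , 0ℤ

Nonneg : V3 → Set
Nonneg v = 0ᵛ ≤ᵛ v

NonnegMat : Mat → Set
NonnegMat (r₁ , r₂ , r₃) = Nonneg r₁ × Nonneg r₂ × Nonneg r₃

nonneg-+ : ∀ a b c → Nonneg (+ a , + b , + c)
nonneg-+ _ _ _ = +≤+ z≤n , +≤+ z≤n , +≤+ z≤n

dot-monoʳ-≤ : ∀ {r v w} → Nonneg r → v ≤ᵛ w → dot r v ℤ.≤ dot r w
dot-monoʳ-≤ {a , b , c} (0≤a , 0≤b , 0≤c) (x≤x′ , y≤y′ , z≤z′) =
  ℤP.+-mono-≤ (ℤP.+-mono-≤ (scale 0≤a x≤x′) (scale 0≤b y≤y′)) (scale 0≤c z≤z′)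
  where
  scale : ∀ {k i j} → 0ℤ ℤ.≤ k → i ℤ.≤ j → k * i ℤ.≤ k * j
  scale {k} 0≤k = ℤP.*-monoˡ-≤-nonNeg k {{ℤ.nonNegative 0≤k}}

·-monoʳ-≤ : ∀ {A v w} → NonnegMat A → v ≤ᵛ w → A · v ≤ᵛ A · w
·-monoʳ-≤ (0≤r₁ , 0≤r₂ , 0≤r₃) v≤w =
  dot-monoʳ-≤ 0≤r₁ v≤w , dot-monoʳ-≤ 0≤r₂ v≤w , dot-monoʳ-≤ 0≤r₃ v≤w

IsDigit : ℕ → Set
IsDigit d = 1 ≤ d × d ≤ 5

data Digit : ℕ → Set where
  d₁ : Digit 1
  d₂ : Digit 2
  d₃ : Digit 3
  d₄ : Digit 4
  d₅ : Digit 5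

digit : ∀ {d} → IsDigit d → Digit d
digit {1} _ = d₁
digit {2} _ = d₂
digit {3} _ = d₃
digit {4} _ = d₄
digit {5} _ = d₅
digit {0} (() , _)
digit {suc (suc (suc (suc (suc (suc _)))))} (_ , s≤s (s≤s (s≤s (s≤s (s≤s ())))))

M⁻¹ : ℕ → Mat
M⁻¹ 1 = (m 7 , m 7 , n 8) , (n 4 , n 3 , m 4) , (m 6 , m 6 , n 7)
M⁻¹ 2 = (n 7 , n 7 , m 8) , (m 3 , m 4 , n 4) , (m 6 , m 6 , n 7)
M⁻¹ 3 = (n 4 , n 3 , m 4) , (n 3 , n 4 , m 4) , (m 6 , m 6 , n 7)
M⁻¹ 4 = (m 4 , m 3 , n 4) , (n 7 , n 7 , m 8) , (m 6 , m 6 , n 7)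
M⁻¹ 5 = (n 3 , n 4 , m 4) , (m 7 , m 7 , n 8) , (m 6 , m 6 , n 7)
M⁻¹ _ = I₃

M-⊗-M⁻¹ : ∀ {d} → Digit d → M d ⊗ M⁻¹ d ≡ I₃
M-⊗-M⁻¹ d₁ = refl
M-⊗-M⁻¹ d₂ = refl
M-⊗-M⁻¹ d₃ = refl
M-⊗-M⁻¹ d₄ = refl
M-⊗-M⁻¹ d₅ = refl

M⁻¹-⊗-M : ∀ {d} → Digit d → M⁻¹ d ⊗ M d ≡ I₃
M⁻¹-⊗-M d₁ = refl
M⁻¹-⊗-M d₂ = refl
M⁻¹-⊗-M d₃ = refl
M⁻¹-⊗-M d₄ = refl
M⁻¹-⊗-M d₅ = refl

-- ℓ₁ = 0 and ℓ₂ = 0 are the tangents to 𝒳 at (0,1) and at (1,0), and ℓ₃ = 0 is the chord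
-- joining these points, so L w ≥ 0 cuts out the triangle with vertices (1,0,1), (0,1,1),
-- (2,2,3) that encloses the arc 𝒳.
ℓ₁ ℓ₂ ℓ₃ : V3
ℓ₁ = m 1 , m 2 , n 2
ℓ₂ = m 2 , m 1 , n 2
ℓ₃ = n 1 , n 1 , m 1

L : Mat
L = ℓ₁ , ℓ₂ , ℓ₃

-- T d = L (M d) L⁻¹; since T d ≥ 0, M d maps the triangle into itself.
T : ℕ → Mat
T 1 = (n 1 , n 3 , n 6)  , (n 0 , n 1 , n 0)  , (n 0 , n 1 , n 1)
T 2 = (n 4 , n 3 , n 12) , (n 3 , n 1 , n 6)  , (n 2 , n 1 , n 5)
T 3 = (n 4 , n 3 , n 12) , (n 3 , n 4 , n 12) , (n 2 , n 2 , n 7)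
T 4 = (n 1 , n 3 , n 6)  , (n 3 , n 4 , n 12) , (n 1 , n 2 , n 5)
T 5 = (n 1 , n 0 , n 0)  , (n 3 , n 1 , n 6)  , (n 1 , n 0 , n 1)
T _ = I₃

L-⊗-M : ∀ {d} → Digit d → L ⊗ M d ≡ T d ⊗ L
L-⊗-M d₁ = refl
L-⊗-M d₂ = refl
L-⊗-M d₃ = refl
L-⊗-M d₄ = refl
L-⊗-M d₅ = refl

T-nonneg : ∀ {d} → Digit d → NonnegMat (T d)
T-nonneg d₁ = nonneg-+ _ _ _ , nonneg-+ _ _ _ , nonneg-+ _ _ _
T-nonneg d₂ = nonneg-+ _ _ _ , nonneg-+ _ _ _ , nonneg-+ _ _ _
T-nonneg d₃ = nonneg-+ _ _ _ , nonneg-+ _ _ _ , nonneg-+ _ _ _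
T-nonneg d₄ = nonneg-+ _ _ _ , nonneg-+ _ _ _ , nonneg-+ _ _ _
T-nonneg d₅ = nonneg-+ _ _ _ , nonneg-+ _ _ _ , nonneg-+ _ _ _

third-via-L : ∀ w → third w ≡ dot (n 1 , n 1 , n 3) (L · w)
third-via-L (x , y , z) =
  solve 3 (λ x y z → z
    := con (n 1) :* (con (m 1) :* x :+ con (m 2) :* y :+ con (n 2) :* z)
       :+ con (n 1) :* (con (m 2) :* x :+ con (m 1) :* y :+ con (n 2) :* z)
       :+ con (n 3) :* (con (n 1) :* x :+ con (n 1) :* y :+ con (m 1) :* z))
    refl x y z

record _⊑_ (w w′ : V3) : Set where
  constructor by-L
  field L·-≤ᵛ : L · w ≤ᵛ L · w′

M-mono-⊑ : ∀ {d w w′} → Digit d → w ⊑ w′ → M d · w ⊑ M d · w′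
M-mono-⊑ {d} {w} {w′} δ (by-L w⊑w′) = by-L $
  subst₂ _≤ᵛ_ (sym (L-·-M w)) (sym (L-·-M w′)) (·-monoʳ-≤ (T-nonneg δ) w⊑w′)
  where
  L-·-M : ∀ v → L · (M d · v) ≡ T d · (L · v)
  L-·-M v = begin
    L · (M d · v)     ≡⟨ ·-⊗ L (M d) v ⟩
    (L ⊗ M d) · v     ≡⟨ cong (_· v) (L-⊗-M δ) ⟩
    (T d ⊗ L) · v     ≡⟨ sym (·-⊗ (T d) L v) ⟩
    T d · (L · v)     ∎
    where open ≡-Reasoning

third-mono-⊑ : ∀ {w w′} → w ⊑ w′ → third w ℤ.≤ third w′
third-mono-⊑ {w} {w′} (by-L w⊑w′) =
  subst₂ ℤ._≤_ (sym (third-via-L w)) (sym (third-via-L w′)) (dot-monoʳ-≤ (nonneg-+ 1 1 3) w⊑w′)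

applyDigits-mono-⊑ : ∀ {ds w w′} → All IsDigit ds → w ⊑ w′ → applyDigits ds w ⊑ applyDigits ds w′
applyDigits-mono-⊑ []       w⊑w′ = w⊑w′
applyDigits-mono-⊑ (p ∷ ps) w⊑w′ = M-mono-⊑ (digit p) (applyDigits-mono-⊑ ps w⊑w′)

applyDigits-⊙ : ∀ ds k w → applyDigits ds (k ⊙ w) ≡ k ⊙ applyDigits ds w
applyDigits-⊙ []       k w = refl
applyDigits-⊙ (d ∷ ds) k w =
  trans (cong (M d ·_) (applyDigits-⊙ ds k w)) (·-⊙ (M d) k (applyDigits ds w))

0⊑e₁₀ : 0ᵛ ⊑ e₁₀
0⊑e₁₀ = by-L $ +≤+ z≤n , +≤+ z≤n , +≤+ z≤n

0⊑e₀₁ : 0ᵛ ⊑ e₀₁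
0⊑e₀₁ = by-L $ +≤+ z≤n , +≤+ z≤n , +≤+ z≤n

third-⊙ : ∀ k v → third (k ⊙ v) ≡ k * third v
third-⊙ k (_ , _ , _) = refl

third-applyDigits-nonneg : ∀ {ds w} → All IsDigit ds → 0ᵛ ⊑ w → 0ℤ ℤ.≤ third (applyDigits ds w)
third-applyDigits-nonneg {ds} {w} ps 0⊑w =
  subst (ℤ._≤ third (applyDigits ds w)) third≡0 (third-mono-⊑ (applyDigits-mono-⊑ ps 0⊑w))
  where
  third≡0 : third (applyDigits ds 0ᵛ) ≡ 0ℤ
  third≡0 = trans (cong third (applyDigits-⊙ ds 0ℤ 0ᵛ))
                  (trans (third-⊙ 0ℤ (applyDigits ds 0ᵛ)) (ℤP.*-zeroˡ (third (applyDigits ds 0ᵛ))))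

applyInverse : List ℕ → V3 → V3
applyInverse []       w = w
applyInverse (d ∷ ds) w = applyInverse ds (M⁻¹ d · w)

·-inverse : ∀ A B → A ⊗ B ≡ I₃ → ∀ w → A · (B · w) ≡ w
·-inverse A B AB≡I w = trans (·-⊗ A B w) (trans (cong (_· w) AB≡I) (I₃-· w))

applyDigits-applyInverse : ∀ {ds} → All IsDigit ds → ∀ w → applyDigits ds (applyInverse ds w) ≡ w
applyDigits-applyInverse []                 w = refl
applyDigits-applyInverse {d ∷ ds} (p ∷ ps) w =
  trans (cong (M d ·_) (applyDigits-applyInverse ps (M⁻¹ d · w)))
        (·-inverse (M d) (M⁻¹ d) (M-⊗-M⁻¹ (digit p)) w)

applyInverse-applyDigits : ∀ {ds} → All IsDigit ds → ∀ w → applyInverse ds (applyDigits ds w) ≡ w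
applyInverse-applyDigits []                 w = refl
applyInverse-applyDigits {d ∷ ds} (p ∷ ps) w =
  trans (cong (applyInverse ds) (·-inverse (M⁻¹ d) (M d) (M⁻¹-⊗-M (digit p)) (applyDigits ds w)))
        (applyInverse-applyDigits ps w)

applyDigits-injective : ∀ {ds v w} → All IsDigit ds → applyDigits ds v ≡ applyDigits ds w → v ≡ w
applyDigits-injective {ds} {v} {w} ps eq = begin
  v                                    ≡⟨ sym (applyInverse-applyDigits ps v) ⟩
  applyInverse ds (applyDigits ds v)   ≡⟨ cong (applyInverse ds) eq ⟩
  applyInverse ds (applyDigits ds w)   ≡⟨ applyInverse-applyDigits ps w ⟩
  w                                    ∎
  where open ≡-Reasoning

OnCone : V3 → Set
OnCone (x , y , z) = x * x + x * y + y * y ≡ z * z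

Positive³ : V3 → Set
Positive³ (x , y , z) = 0ℤ ℤ.< x × 0ℤ ℤ.< y × 0ℤ ℤ.< z

*-pos : ∀ {i j} → 0ℤ ℤ.< i → 0ℤ ℤ.< j → 0ℤ ℤ.< i * j
*-pos {i} {j} 0<i 0<j =
  subst (ℤ._< i * j) (ℤP.*-zeroʳ i) (ℤP.*-monoˡ-<-pos i {{ℤ.positive 0<i}} 0<j)

*-nonneg : ∀ {i j} → 0ℤ ℤ.≤ i → 0ℤ ℤ.≤ j → 0ℤ ℤ.≤ i * j
*-nonneg {i} {j} 0≤i 0≤j =
  subst (ℤ._≤ i * j) (ℤP.*-zeroʳ i) (ℤP.*-monoˡ-≤-nonNeg i {{ℤ.nonNegative 0≤i}} 0≤j)

i<i+j : ∀ {i j} → 0ℤ ℤ.< j → i ℤ.< i + j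
i<i+j {i} {j} 0<j = subst (ℤ._< i + j) (ℤP.+-identityʳ i) (ℤP.+-monoʳ-< i 0<j)

square-mono-≤ : ∀ {i j} → 0ℤ ℤ.≤ i → i ℤ.≤ j → i * i ℤ.≤ j * j
square-mono-≤ {i} {j} 0≤i i≤j =
  ℤP.≤-trans (ℤP.*-monoˡ-≤-nonNeg i {{ℤ.nonNegative 0≤i}} i≤j)
             (ℤP.*-monoʳ-≤-nonNeg j {{ℤ.nonNegative (ℤP.≤-trans 0≤i i≤j)}} i≤j)

square-mono-< : ∀ {i j} → 0ℤ ℤ.≤ i → i ℤ.< j → i * i ℤ.< j * j
square-mono-< {i} {j} 0≤i i<j =
  ℤP.≤-<-trans (ℤP.*-monoˡ-≤-nonNeg i {{ℤ.nonNegative 0≤i}} (ℤP.<⇒≤ i<j))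
               (ℤP.*-monoʳ-<-pos j {{ℤ.positive (ℤP.≤-<-trans 0≤i i<j)}} i<j)

square-cancel-< : ∀ {i j} → 0ℤ ℤ.≤ j → i * i ℤ.< j * j → i ℤ.< j
square-cancel-< 0≤j i²<j² = ℤP.≰⇒> (λ j≤i → ℤP.<⇒≱ i²<j² (square-mono-≤ 0≤j j≤i))

square-cancel-≤ : ∀ {i j} → 0ℤ ℤ.≤ j → i * i ℤ.≤ j * j → i ℤ.≤ j
square-cancel-≤ 0≤j i²≤j² = ℤP.≮⇒≥ (λ j<i → ℤP.<⇒≱ (square-mono-< 0≤j j<i) i²≤j²)

square-injective : ∀ {i j} → 0ℤ ℤ.≤ i → 0ℤ ℤ.≤ j → i * i ≡ j * j → i ≡ j
square-injective 0≤i 0≤j i²≡j² =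
  ℤP.≤-antisym (square-cancel-≤ 0≤j (ℤP.≤-reflexive i²≡j²))
               (square-cancel-≤ 0≤i (ℤP.≤-reflexive (sym i²≡j²)))

-- (2z)² = (x + 2y)² + 3x², so x + 2y < 2z, and by integrality the gap is at least 1.
onCone-swap : ∀ {x y z} → OnCone (x , y , z) → OnCone (y , x , z)
onCone-swap {x} {y} =
  trans (solve 2 (λ x y → y :* y :+ y :* x :+ x :* x := x :* x :+ x :* y :+ y :* y) refl x y)

tangent-gap : ∀ {x y z} → 0ℤ ℤ.< x → 0ℤ ℤ.≤ y → 0ℤ ℤ.≤ z → OnCone (x , y , z) →
              1ℤ ℤ.≤ dot ℓ₁ (x , y , z)
tangent-gap {x} {y} {z} 0<x 0≤y 0≤z cone =
  subst₂ ℤ._≤_ (solve 1 (λ p → (con 1ℤ :+ p) :- p := con 1ℤ) refl p)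
             (solve 3 (λ x y z → con (n 2) :* z :- (x :+ con (n 2) :* y)
                              := con (m 1) :* x :+ con (m 2) :* y :+ con (n 2) :* z) refl x y z)
             (ℤP.+-monoˡ-≤ (- p) (ℤP.i<j⇒suc[i]≤j p<q))
  where
  p q : ℤ
  p = x + + 2 * y
  q = + 2 * z
  q² : q * q ≡ p * p + + 3 * (x * x)
  q² = begin
    q * q
      ≡⟨ solve 1 (λ z → con (n 2) :* z :* (con (n 2) :* z) := con (n 4) :* (z :* z)) refl z ⟩
    + 4 * (z * z)
      ≡⟨ cong (+ 4 *_) (sym cone) ⟩
    + 4 * (x * x + x * y + y * y)
      ≡⟨ solve 2 (λ x y → con (n 4) :* (x :* x :+ x :* y :+ y :* y)
                       := (x :+ con (n 2) :* y) :* (x :+ con (n 2) :* y) :+ con (n 3) :* (x :* x))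
                 refl x y ⟩
    p * p + + 3 * (x * x)
      ∎
    where open ≡-Reasoning
  p<q : p ℤ.< q
  p<q = square-cancel-< (*-nonneg {+ 2} (+≤+ z≤n) 0≤z)
          (subst (p * p ℤ.<_) (sym q²) (i<i+j (*-pos {+ 3} (+<+ (s≤s z≤n)) (*-pos 0<x 0<x))))

chord-bound : ∀ {x y z} → 0ℤ ℤ.≤ x → 0ℤ ℤ.≤ y → OnCone (x , y , z) → 0ℤ ℤ.≤ dot ℓ₃ (x , y , z)
chord-bound {x} {y} {z} 0≤x 0≤y cone =
  subst (0ℤ ℤ.≤_) (solve 3 (λ x y z → x :+ y :- z := con (n 1) :* x :+ con (n 1) :* y :+ con (m 1) :* z)
                         refl x y z)
        (ℤP.i≤j⇒0≤j-i (square-cancel-≤ (ℤP.+-mono-≤ 0≤x 0≤y) z²≤[x+y]²))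
  where
  z²≤[x+y]² : z * z ℤ.≤ (x + y) * (x + y)
  z²≤[x+y]² = subst₂ ℤ._≤_ cone
    (solve 2 (λ x y → x :* x :+ x :* y :+ y :* y :+ x :* y := (x :+ y) :* (x :+ y)) refl x y)
    (ℤP.i≤i+j _ (x * y) {{ℤ.nonNegative (*-nonneg 0≤x 0≤y)}})

corners-⊑ : ∀ {u} → Positive³ u → OnCone u → e₁₀ ⊑ u × e₀₁ ⊑ u
corners-⊑ {x , y , z} (0<x , 0<y , 0<z) cone =
  by-L (1≤ℓ₁ , ℤP.≤-trans (+≤+ z≤n) 1≤ℓ₂ , 0≤ℓ₃) , by-L (ℤP.≤-trans (+≤+ z≤n) 1≤ℓ₁ , 1≤ℓ₂ , 0≤ℓ₃)
  where
  0≤x : 0ℤ ℤ.≤ x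
  0≤x = ℤP.<⇒≤ 0<x
  0≤y : 0ℤ ℤ.≤ y
  0≤y = ℤP.<⇒≤ 0<y
  0≤z : 0ℤ ℤ.≤ z
  0≤z = ℤP.<⇒≤ 0<z
  1≤ℓ₁ : 1ℤ ℤ.≤ dot ℓ₁ (x , y , z)
  1≤ℓ₁ = tangent-gap 0<x 0≤y 0≤z cone
  1≤ℓ₂ : 1ℤ ℤ.≤ dot ℓ₂ (x , y , z)
  1≤ℓ₂ = subst (1ℤ ℤ.≤_) (cong (_+ n 2 * z) (ℤP.+-comm (m 1 * y) (m 2 * x)))
           (tangent-gap 0<y 0≤x 0≤z (onCone-swap {x} {y} {z} cone))
  0≤ℓ₃ : 0ℤ ℤ.≤ dot ℓ₃ (x , y , z)
  0≤ℓ₃ = chord-bound 0≤x 0≤y cone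

onCone-⊙ : ∀ {k l u v} → k ≢ 0ℤ → k ⊙ u ≡ l ⊙ v → OnCone v → OnCone u
onCone-⊙ {k} {l} {x , y , z} {x′ , y′ , z′} k≢0 ku≡lv cone =
  ℤP.*-cancelˡ-≡ (k * k) _ _ {{ℤP.i*j≢0 k k}} (begin
    k * k * Q x y               ≡⟨ Q-⊙ k x y ⟩
    Q (k * x) (k * y)           ≡⟨ cong₂ Q (cong proj₁ ku≡lv) (cong (proj₁ ∘ proj₂) ku≡lv) ⟩
    Q (l * x′) (l * y′)         ≡⟨ sym (Q-⊙ l x′ y′) ⟩
    l * l * Q x′ y′             ≡⟨ cong (l * l *_) cone ⟩
    l * l * (z′ * z′)           ≡⟨ square-⊙ l z′ ⟩
    (l * z′) * (l * z′)         ≡⟨ cong (λ t → t * t) (sym (cong (proj₂ ∘ proj₂) ku≡lv)) ⟩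
    (k * z) * (k * z)           ≡⟨ sym (square-⊙ k z) ⟩
    k * k * (z * z)             ∎)
  where
  instance
    k-nonZero : ℤ.NonZero k
    k-nonZero = ℤ.≢-nonZero k≢0
  open ≡-Reasoning
  Q : ℤ → ℤ → ℤ
  Q x y = x * x + x * y + y * y
  Q-⊙ : ∀ k x y → k * k * Q x y ≡ Q (k * x) (k * y)
  Q-⊙ = solve 3 (λ k x y → k :* k :* (x :* x :+ x :* y :+ y :* y)
                        := k :* x :* (k :* x) :+ k :* x :* (k :* y) :+ k :* y :* (k :* y)) refl
  square-⊙ : ∀ k z → k * k * (z * z) ≡ (k * z) * (k * z)
  square-⊙ = solve 2 (λ k z → k :* k :* (z :* z) := k :* z :* (k :* z)) refl

positive³-⊙ : ∀ {k l u v} → 0ℤ ℤ.< k → 0ℤ ℤ.< l → k ⊙ u ≡ l ⊙ v → Positive³ v → Positive³ u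
positive³-⊙ {k} {l} {x , y , z} 0<k 0<l ku≡lv (0<x′ , 0<y′ , 0<z′) =
  cancel (cong proj₁ ku≡lv) 0<x′ , cancel (cong (proj₁ ∘ proj₂) ku≡lv) 0<y′ ,
  cancel (cong (proj₂ ∘ proj₂) ku≡lv) 0<z′
  where
  cancel : ∀ {i j} → k * i ≡ l * j → 0ℤ ℤ.< j → 0ℤ ℤ.< i
  cancel {i} ki≡lj 0<j = ℤP.*-cancelˡ-<-nonNeg k {{ℤ.nonNegative (ℤP.<⇒≤ 0<k)}}
    (subst₂ ℤ._<_ (sym (ℤP.*-zeroʳ k)) (sym ki≡lj) (*-pos 0<l 0<j))

on-edge₀₁ : ∀ {y z} → 0ℤ ℤ.≤ y → 0ℤ ℤ.≤ z → OnCone (0ℤ , y , z) → (0ℤ , y , z) ≡ z ⊙ e₀₁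
on-edge₀₁ {y} {z} 0≤y 0≤z cone =
  cong-triple (sym (ℤP.*-zeroʳ z)) (trans y≡z (sym (ℤP.*-identityʳ z))) (sym (ℤP.*-identityʳ z))
  where
  y≡z : y ≡ z
  y≡z = square-injective 0≤y 0≤z
    (trans (solve 1 (λ y → y :* y := con 0ℤ :* con 0ℤ :+ con 0ℤ :* y :+ y :* y) refl y) cone)

on-edge₁₀ : ∀ {x z} → 0ℤ ℤ.≤ x → 0ℤ ℤ.≤ z → OnCone (x , 0ℤ , z) → (x , 0ℤ , z) ≡ z ⊙ e₁₀
on-edge₁₀ {x} {z} 0≤x 0≤z cone =
  cong-triple (trans x≡z (sym (ℤP.*-identityʳ z))) (sym (ℤP.*-zeroʳ z)) (sym (ℤP.*-identityʳ z))
  where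
  x≡z : x ≡ z
  x≡z = square-injective 0≤x 0≤z
    (trans (solve 1 (λ x → x :* x := x :* x :+ x :* con 0ℤ :+ con 0ℤ :* con 0ℤ) refl x) cone)

record IsRatio (q : ℚ) (p r : ℤ) : Set where
  constructor cross
  field ↥q*r≡p*↧q : ↥ q * r ≡ p * ↧ q

fromℤ : ℤ → ℚ
fromℤ i = mkℚ i 0 (Coprime.sym (Coprime.1-coprimeTo ℤ.∣ i ∣))

toℚ≡fromℤ : ∀ i → toℚ i ≡ fromℤ i
toℚ≡fromℤ i = ℚP.fromℚᵘ-toℚᵘ (fromℤ i)

*-toℚ⇒ratio : ∀ q {p r} → q ℚ.* toℚ r ≡ toℚ p → IsRatio q p r
*-toℚ⇒ratio q@(mkℚ _ d _) {p} {r} eq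
  with ℚᵘP.≃-trans (ℚᵘP.≃-sym (ℚP.toℚᵘ-homo-* q (fromℤ r)))
         (ℚP.toℚᵘ-cong (trans (cong (q ℚ.*_) (sym (toℚ≡fromℤ r))) (trans eq (toℚ≡fromℤ p))))
... | ℚᵘ.*≡* eq′ = cross $
  trans (sym (ℤP.*-identityʳ _)) (trans eq′ (cong (λ t → p * + suc t) (ℕP.*-identityʳ d)))

cross-from-common-factor : ∀ a b {g i j} → a * g ≡ i → b * g ≡ j → a * j ≡ i * b
cross-from-common-factor a b {g} refl refl =
  solve 3 (λ a b g → a :* (b :* g) := a :* g :* b) refl a b g

/-ratio : ∀ i k → IsRatio (i ℚ./ suc k) i (+ suc k)
/-ratio i k = cross $ cross-from-common-factor (↥ q) (↧ q) (ℚP.↥-/ i (suc k)) (ℚP.↧-/ i (suc k))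
  where
  q : ℚ
  q = i ℚ./ suc k

ratio-cross : ∀ {q p r p′ r′} → IsRatio q p r → IsRatio q p′ r′ → p * r′ ≡ p′ * r
ratio-cross {q} {p} {r} {p′} {r′} (cross q≡p/r) (cross q≡p′/r′) = ℤP.*-cancelʳ-≡ _ _ (↧ q) (begin
  p * r′ * ↧ q       ≡⟨ solve 3 (λ p r′ d → p :* r′ :* d := p :* d :* r′) refl p r′ (↧ q) ⟩
  p * ↧ q * r′       ≡⟨ cong (_* r′) (sym q≡p/r) ⟩
  ↥ q * r * r′       ≡⟨ solve 3 (λ n r r′ → n :* r :* r′ := n :* r′ :* r) refl (↥ q) r r′ ⟩
  ↥ q * r′ * r       ≡⟨ cong (_* r) q≡p′/r′ ⟩
  p′ * ↧ q * r       ≡⟨ solve 3 (λ p′ d r → p′ :* d :* r := p′ :* r :* d) refl p′ (↧ q) r ⟩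
  p′ * r * ↧ q       ∎)
  where open ≡-Reasoning

ratio-unique : ∀ {q q′ p r} → r ≢ 0ℤ → IsRatio q p r → IsRatio q′ p r → q ≡ q′
ratio-unique {q} {q′} {p} {r} r≢0 (cross q≡p/r) (cross q′≡p/r) =
  ℚP.≃⇒≡ (ℚ.*≡* (ℤP.*-cancelʳ-≡ _ _ r {{ℤ.≢-nonZero r≢0}} (begin
    ↥ q * ↧ q′ * r     ≡⟨ solve 3 (λ n d′ r → n :* d′ :* r := n :* r :* d′) refl (↥ q) (↧ q′) r ⟩
    ↥ q * r * ↧ q′     ≡⟨ cong (_* ↧ q′) q≡p/r ⟩
    p * ↧ q * ↧ q′     ≡⟨ solve 3 (λ p d d′ → p :* d :* d′ := p :* d′ :* d) refl p (↧ q) (↧ q′) ⟩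
    p * ↧ q′ * ↧ q     ≡⟨ cong (_* ↧ q) (sym q′≡p/r) ⟩
    ↥ q′ * r * ↧ q     ≡⟨ solve 3 (λ n′ r d → n′ :* r :* d := n′ :* d :* r) refl (↥ q′) r (↧ q) ⟩
    ↥ q′ * ↧ q * r     ∎)))
  where open ≡-Reasoning

ratio-scale : ∀ {q p r} k → IsRatio q p r → IsRatio q (k * p) (k * r)
ratio-scale {q} {p} {r} k (cross q≡p/r) = cross $ begin
  ↥ q * (k * r)      ≡⟨ solve 3 (λ n k r → n :* (k :* r) := k :* (n :* r)) refl (↥ q) k r ⟩
  k * (↥ q * r)      ≡⟨ cong (k *_) q≡p/r ⟩
  k * (p * ↧ q)      ≡⟨ sym (ℤP.*-assoc k p (↧ q)) ⟩
  k * p * ↧ q        ∎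
  where open ≡-Reasoning

represents-ratios : ∀ {w₁ w₂ w₃ x y} → Represents (w₁ , w₂ , w₃) (x , y) →
                    IsRatio x w₁ w₃ × IsRatio y w₂ w₃
represents-ratios {x = x} {y} (_ , x≡ , y≡) = *-toℚ⇒ratio x x≡ , *-toℚ⇒ratio y y≡

represents-⊙-unique : ∀ {k w Z Z′} → Represents (k ⊙ w) Z → Represents w Z′ → Z ≡ Z′
represents-⊙-unique {k} {w₁ , w₂ , w₃} {x , y} {x′ , y′} R@(kw₃≢0 , _) R′
  with represents-ratios R | represents-ratios R′
... | x≡ , y≡ | x′≡ , y′≡ =
  cong₂ _,_ (ratio-unique kw₃≢0 x≡ (ratio-scale k x′≡)) (ratio-unique kw₃≢0 y≡ (ratio-scale k y′≡))

represents-reduced : ∀ {w x y a b k} → Represents w (x , y) → x ≡ + a ℚ./ suc k → y ≡ + b ℚ./ suc k →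
                     (+ suc k) ⊙ w ≡ third w ⊙ (+ a , + b , + suc k)
represents-reduced {w₁ , w₂ , w₃} {a = a} {b} {k} R refl refl with represents-ratios {w₁} {w₂} {w₃} R
... | x≡ , y≡ = cong-triple (swap (ratio-cross x≡ (/-ratio (+ a) k)))
                            (swap (ratio-cross y≡ (/-ratio (+ b) k)))
                            (ℤP.*-comm (+ suc k) w₃)
  where
  swap : ∀ {i j} → i * + suc k ≡ j * w₃ → + suc k * i ≡ w₃ * j
  swap {i} {j} eq = trans (ℤP.*-comm (+ suc k) i) (trans eq (ℤP.*-comm j w₃))

coprime-gcd-divisor : ∀ {a b h c} → gcd (gcd a b) h ≡ 1 → h ∣ c ℕ.* a → h ∣ c ℕ.* b → h ∣ c
coprime-gcd-divisor {a} {b} {h} {c} gcd≡1 h∣ca h∣cb =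
  Coprime.coprime-divisor {h} {gcd a b} (Coprime.sym {gcd a b} (Coprime.gcd≡1⇒coprime {gcd a b} gcd≡1))
    (subst (h ∣_) (trans (sym (c*gcd[m,n]≡gcd[cm,cn] c a b)) (ℕP.*-comm c (gcd a b)))
      (gcd-greatest h∣ca h∣cb))

height-∣ : ∀ {w Z h} → Represents w Z → HasHt Z h → h ∣ ℤ.∣ third w ∣
height-∣ {w₁ , w₂ , w₃} {x , y} R (a , b , k , refl , gcd≡1 , x≡ , y≡) =
  coprime-gcd-divisor gcd≡1 (∣-abs (cong proj₁ hw≡w₃U)) (∣-abs (cong (proj₁ ∘ proj₂) hw≡w₃U))
  where
  hw≡w₃U : (+ suc k) ⊙ (w₁ , w₂ , w₃) ≡ w₃ ⊙ (+ a , + b , + suc k)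
  hw≡w₃U = represents-reduced R x≡ y≡
  ∣-abs : ∀ {i c} → + suc k * i ≡ w₃ * + c → suc k ∣ ℤ.∣ w₃ ∣ ℕ.* c
  ∣-abs {i} {c} eq = divides ℤ.∣ i ∣ (begin
    ℤ.∣ w₃ ∣ ℕ.* c        ≡⟨ sym (ℤP.abs-* w₃ (+ c)) ⟩
    ℤ.∣ w₃ * + c ∣        ≡⟨ cong ℤ.∣_∣ (sym eq) ⟩
    ℤ.∣ + suc k * i ∣     ≡⟨ ℤP.abs-* (+ suc k) i ⟩
    suc k ℕ.* ℤ.∣ i ∣     ≡⟨ ℕP.*-comm (suc k) ℤ.∣ i ∣ ⟩
    ℤ.∣ i ∣ ℕ.* suc k     ∎)
    where open ≡-Reasoning

height-≤ : ∀ {w Z h} → Represents w Z → HasHt Z h → h ≤ ℤ.∣ third w ∣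
height-≤ {w@(_ , _ , _)} {_ , _} R@(w₃≢0 , _) H = ∣⇒≤ {{ℤ.≢-nonZero w₃≢0}} (height-∣ {w} R H)

represents-≢0 : ∀ {w Z} → Represents w Z → third w ≢ 0ℤ
represents-≢0 {_ , _ , _} {_ , _} (w₃≢0 , _) = w₃≢0

represents-endpoint : ∀ {ds v k e Z Z′} → v ≡ k ⊙ e →
                      Represents (applyDigits ds v) Z → Represents (applyDigits ds e) Z′ → Z ≡ Z′
represents-endpoint {ds} {k = k} {e} {Z} refl R R′ =
  represents-⊙-unique {k} {applyDigits ds e} (subst (λ w → Represents w Z) (applyDigits-⊙ ds k e) R) R′

positive-representative : ∀ {ds Z₁₀ Z₀₁ Z} →
  Represents (applyDigits ds e₁₀) Z₁₀ → Represents (applyDigits ds e₀₁) Z₀₁ →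
  InCylinder ds Z → Z ≢ Z₁₀ → Z ≢ Z₀₁ →
  ∃[ v ] Positive³ v × OnCone v × Represents (applyDigits ds v) Z
positive-representative {ds} _ R₀₁ ((+0 , v₂ , v₃) , (0<v₃ , _ , 0≤v₂ , cone) , R) _ Z≢Z₀₁ =
  ⊥-elim (Z≢Z₀₁ (represents-endpoint {ds} {k = v₃} (on-edge₀₁ 0≤v₂ (ℤP.<⇒≤ 0<v₃) cone) R R₀₁))
positive-representative {ds} R₁₀ _ ((+[1+ _ ] , +0 , v₃) , (0<v₃ , 0≤v₁ , _ , cone) , R) Z≢Z₁₀ _ =
  ⊥-elim (Z≢Z₁₀ (represents-endpoint {ds} {k = v₃} (on-edge₁₀ 0≤v₁ (ℤP.<⇒≤ 0<v₃) cone) R R₁₀))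
positive-representative _ _ ((v₁@(+[1+ _ ]) , v₂@(+[1+ _ ]) , v₃) , (0<v₃ , _ , _ , cone) , R) _ _ =
  (v₁ , v₂ , v₃) , (+<+ (s≤s z≤n) , +<+ (s≤s z≤n) , 0<v₃) , cone , R
positive-representative _ _ ((-[1+ _ ] , _ , _) , (_ , () , _ , _) , _) _ _
positive-representative _ _ ((+[1+ _ ] , -[1+ _ ] , _) , (_ , _ , () , _) , _) _ _

integral-lift : ∀ {ds v Z h} → All IsDigit ds → Positive³ v → OnCone v →
  Represents (applyDigits ds v) Z → HasHt Z h →
  ∃[ u ] Positive³ u × OnCone u × third (applyDigits ds u) ≡ + h
integral-lift {ds} {v} {x , y} ps v>0 v∈cone R (a , b , k , refl , _ , x≡ , y≡) =
  u , positive³-⊙ {third w} {+ suc k} {u} {v} 0<w₃ (+<+ (s≤s z≤n)) w₃u≡hv v>0 ,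
  onCone-⊙ {third w} {+ suc k} {u} {v} w₃≢0 w₃u≡hv v∈cone ,
  cong third (applyDigits-applyInverse ps U)
  where
  w U u : V3
  w = applyDigits ds v
  U = + a , + b , + suc k
  u = applyInverse ds U
  w₃≢0 : third w ≢ 0ℤ
  w₃≢0 = represents-≢0 {w} {x , y} R
  0<w₃ : 0ℤ ℤ.< third w
  0<w₃ = ℤP.≤∧≢⇒< (ℤP.≤-trans (third-applyDigits-nonneg ps 0⊑e₁₀)
                              (third-mono-⊑ (applyDigits-mono-⊑ ps (proj₁ (corners-⊑ {v} v>0 v∈cone)))))
                  (λ 0≡w₃ → w₃≢0 (sym 0≡w₃))
  w₃u≡hv : third w ⊙ u ≡ (+ suc k) ⊙ v
  w₃u≡hv = applyDigits-injective ps (begin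
    applyDigits ds (third w ⊙ u)    ≡⟨ applyDigits-⊙ ds (third w) u ⟩
    third w ⊙ applyDigits ds u      ≡⟨ cong (third w ⊙_) (applyDigits-applyInverse ps U) ⟩
    third w ⊙ U                     ≡⟨ sym (represents-reduced {w} R x≡ y≡) ⟩
    (+ suc k) ⊙ w                   ≡⟨ sym (applyDigits-⊙ ds (+ suc k) v) ⟩
    applyDigits ds ((+ suc k) ⊙ v)  ∎)
    where open ≡-Reasoning

endpoint-height-≤ : ∀ {ds e u Z h′ h} → All IsDigit ds → 0ᵛ ⊑ e → e ⊑ u →
  Represents (applyDigits ds e) Z → HasHt Z h′ → third (applyDigits ds u) ≡ + h → h′ ≤ h
endpoint-height-≤ {ds} {e} {u} {h = h} ps 0⊑e e⊑u R H third≡h =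
  ℕP.≤-trans (height-≤ {applyDigits ds e} R H) (ℤP.drop‿+≤+ (begin
    + ℤ.∣ third (applyDigits ds e) ∣  ≡⟨ ℤP.0≤i⇒+∣i∣≡i (third-applyDigits-nonneg ps 0⊑e) ⟩
    third (applyDigits ds e)          ≤⟨ third-mono-⊑ (applyDigits-mono-⊑ ps e⊑u) ⟩
    third (applyDigits ds u)          ≡⟨ third≡h ⟩
    + h                               ∎))
  where open ℤP.≤-Reasoning

theorem2p15 : (ds : List ℕ) → All (λ d → (1 ≤ d) × (d ≤ 5)) ds →
    (Z₁₀ Z₀₁ Z : Point) →
    Represents (applyDigits ds (1ℤ , 0ℤ , 1ℤ)) Z₁₀ →
    Represents (applyDigits ds (0ℤ , 1ℤ , 1ℤ)) Z₀₁ →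
    InCylinder ds Z → Z ≢ Z₁₀ → Z ≢ Z₀₁ →
    (h₁₀ h₀₁ h : ℕ) → HasHt Z₁₀ h₁₀ → HasHt Z₀₁ h₀₁ → HasHt Z h →
    h₁₀ ⊔ h₀₁ ≤ h
theorem2p15 ds ps Z₁₀ Z₀₁ Z R₁₀ R₀₁ Z∈C Z≢Z₁₀ Z≢Z₀₁ h₁₀ h₀₁ h H₁₀ H₀₁ H
  with positive-representative {ds} R₁₀ R₀₁ Z∈C Z≢Z₁₀ Z≢Z₀₁
... | v , v>0 , v∈cone , R
  with integral-lift ps v>0 v∈cone R H
... | u , u>0 , u∈cone , third≡h
  with corners-⊑ {u} u>0 u∈cone
... | e₁₀⊑u , e₀₁⊑u =
  ℕP.⊔-lub (endpoint-height-≤ ps 0⊑e₁₀ e₁₀⊑u R₁₀ H₁₀ third≡h)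
           (endpoint-height-≤ ps 0⊑e₀₁ e₀₁⊑u R₀₁ H₀₁ third≡h)
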